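{- Let $C$ be a linear locally recoverable code with availability $t$, symmetric recovery sets, and minimum distance $d$. If $t\ge1$ then $d\ge2$, and if $t\ge 2$ then $d\ge 3$.
   Context: A linear code $C\subseteq\mathbb{F}_q^n$ has availability $t$ if for every position $i\in[n]$ there are pairwise disjoint recovery sets $A_{i1},\dots,A_{it}\subseteq[n]\setminus\{i\}$ such that, for each $j$, the entry $c_i$ of every codeword $\mathbf c\in C$ is a function of $\mathbf c|_{A_{ij}}$. The recovery sets are symmetric if for every $j$, $k\in A_{ij}$ if and only if $i\in A_{kj}$ (so that for each $j$ the sets $B_{ij}=A_{ij}\cup\{i\}$ form a partition of $[n]$). -}

module Defs where

open import Level using (Level; _⊔_; suc)
open import Data.Nat using (ℕ; _≤_)
open import Data.Fin using (Fin)
open import Data.Fin.Subset using (Subset; _∈_; _∉_)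
open import Data.List using (List; length; filter; allFin)
open import Data.List.Relation.Unary.Any using (Any)
open import Data.Product using (Σ; ∃; _×_; _,_)
open import Relation.Nullary using (¬_; Dec; ¬?)
open import Relation.Binary.PropositionalEquality using (_≡_)
open import Algebra.Bundles using (CommutativeRing)

record FiniteField (c ℓ : Level) : Set (suc (c ⊔ ℓ)) where
  field
    commRing : CommutativeRing c ℓ
  open CommutativeRing commRing public
  field
    _≟_      : (x y : Carrier) → Dec (x ≈ y)
    0≉1      : ¬ (0# ≈ 1#)
    inverse  : (x : Carrier) → ¬ (x ≈ 0#) → Σ Carrier (λ y → (x * y) ≈ 1#)
    elements : List Carrier
    complete : (x : Carrier) → Any (x ≈_) elements

module _ {c ℓ : Level} (F : FiniteField c ℓ) where
  open FiniteField F

  Word : ℕ → Set c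
  Word n = Fin n → Carrier

  record IsLinearCode {n : ℕ} (C : Word n → Set ℓ) : Set (c ⊔ ℓ) where
    field
      respects : ∀ {x y} → (∀ k → x k ≈ y k) → C x → C y
      zero∈    : C (λ _ → 0#)
      +-closed : ∀ {x y} → C x → C y → C (λ k → x k + y k)
      *-closed : ∀ a {x} → C x → C (λ k → a * x k)

  dist : {n : ℕ} → Word n → Word n → ℕ
  dist {n} x y = length (filter (λ k → ¬? (x k ≟ y k)) (allFin n))

  IsMinDistance : {n : ℕ} → (Word n → Set ℓ) → ℕ → Set (c ⊔ ℓ)
  IsMinDistance {n} C d =
    (Σ (Word n) λ x → Σ (Word n) λ y →
       C x × C y × ¬ (∀ k → x k ≈ y k) × dist x y ≡ d)
    × (∀ x y → C x → C y → ¬ (∀ k → x k ≈ y k) → d ≤ dist x y)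

  -- c_i is a function of c restricted to A (on the code C)
  Recovers : {n : ℕ} → (Word n → Set ℓ) → Fin n → Subset n → Set (c ⊔ ℓ)
  Recovers {n} C i A =
    ∀ x y → C x → C y → (∀ k → k ∈ A → x k ≈ y k) → x i ≈ y i

  -- C has availability t with symmetric recovery sets:
  -- A i j is the j-th recovery set of position i
  HasSymmetricAvailability : {n : ℕ} → (Word n → Set ℓ) → ℕ → Set (c ⊔ ℓ)
  HasSymmetricAvailability {n} C t =
    Σ (Fin n → Fin t → Subset n) λ A →
        (∀ i j → i ∉ A i j)
      × (∀ i j j' → ¬ (j ≡ j') → ∀ k → k ∈ A i j → k ∉ A i j')
      × (∀ i j → Recovers C i (A i j))
      × (∀ i j k → (k ∈ A i j → i ∈ A k j) × (i ∈ A k j → k ∈ A i j))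

{-# OPTIONS --safe #-}
module Submission where

-- Take two distinct codewords x, y at distance d and a position i where they
-- differ. If x and y agreed on a recovery set of i, they would agree at i;
-- so every recovery set of i contains a further position where they differ.
-- As the recovery sets of i are pairwise disjoint and avoid i, t of them
-- give t + 1 distinct positions in the support of x − y, whence d ≥ t + 1.

open import Defs
open import Level using (Level)
open import Data.Nat using (ℕ; _≤_; s≤s)
open import Data.Nat.Properties using (≮⇒≥)
open import Data.Product using (_×_; _,_; ∃)
open import Data.Fin using (Fin) renaming (zero to fzero; suc to fsuc)
open import Data.Fin.Subset using (Subset; _∈_)
open import Data.Fin.Properties using (¬∀⟶∃¬; pigeonhole; <⇒≢)
import Data.Fin.Subset.Properties as Subset
open import Data.List using (List; []; _∷_; length; lookup)
open import Data.List.Relation.Unary.All using (All; []; _∷_)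
open import Data.List.Relation.Unary.AllPairs using ([]; _∷_)
import Data.List.Relation.Unary.All as All
open import Data.List.Relation.Unary.Any using (index)
open import Data.List.Relation.Unary.Any.Properties using (lookup-index)
open import Data.List.Relation.Unary.Unique.Propositional using (Unique)
open import Data.List.Membership.Propositional.Properties
  using (∈-lookup; ∈-filter⁺; ∈-allFin)
open import Data.List.Relation.Binary.Subset.Propositional using (_⊆_)
open import Relation.Nullary using (¬_)
open import Relation.Nullary.Decidable using (decidable-stable; _→-dec_)
open import Relation.Binary.PropositionalEquality
  using (_≡_; _≢_; refl; sym; cong; subst; module ≡-Reasoning)
open import Data.Empty using (⊥-elim)

module _ {a} {A : Set a} where

  lookup-injective : ∀ {ys : List A} → Unique ys →
                     ∀ {i j} → lookup ys i ≡ lookup ys j → i ≡ j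
  lookup-injective (_ ∷ _)      {fzero}  {fzero}  _  = refl
  lookup-injective (y∉ys ∷ _)   {fzero}  {fsuc j} eq = ⊥-elim (All.lookup y∉ys (∈-lookup j) eq)
  lookup-injective (y∉ys ∷ _)   {fsuc i} {fzero}  eq = ⊥-elim (All.lookup y∉ys (∈-lookup i) (sym eq))
  lookup-injective (_ ∷ unique) {fsuc i} {fsuc j} eq with refl ← lookup-injective unique eq = refl

  unique⇒length-≤ : ∀ {xs ys : List A} → Unique ys → ys ⊆ xs → length ys ≤ length xs
  unique⇒length-≤ {xs} {ys} unique ys⊆xs = ≮⇒≥ λ shorter →
    let i , j , i<j , same-position = pigeonhole shorter position
    in <⇒≢ i<j (lookup-injective unique (same-entry i j same-position))
    where
    position : Fin (length ys) → Fin (length xs)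
    position i = index (ys⊆xs (∈-lookup i))

    same-entry : ∀ i j → position i ≡ position j → lookup ys i ≡ lookup ys j
    same-entry i j eq = begin
      lookup ys i           ≡⟨ lookup-index (ys⊆xs (∈-lookup i)) ⟩
      lookup xs (position i) ≡⟨ cong (lookup xs) eq ⟩
      lookup xs (position j) ≡⟨ lookup-index (ys⊆xs (∈-lookup j)) ⟨
      lookup ys j           ∎
      where open ≡-Reasoning

module _ {c ℓ : Level} (F : FiniteField c ℓ) where
  open FiniteField F using (_≈_; _≟_)

  module _ {n : ℕ} (x y : Word F n) where

    Differ : Fin n → Set ℓ
    Differ k = ¬ (x k ≈ y k)

    dist-≥-distinct-differences : ∀ {ks} → Unique ks → All Differ ks → length ks ≤ dist F x y
    dist-≥-distinct-differences unique differ =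
      unique⇒length-≤ unique λ k∈ks → ∈-filter⁺ _ (∈-allFin _) (All.lookup differ k∈ks)

    some-difference : ¬ (∀ k → x k ≈ y k) → ∃ Differ
    some-difference = ¬∀⟶∃¬ n _ (λ k → x k ≟ y k)

  recovery-set-contains-difference :
    ∀ {n} {C : Word F n → Set ℓ} {i} {B : Subset n} {x y} →
    Recovers F C i B → C x → C y → Differ x y i → ∃ λ k → k ∈ B × Differ x y k
  recovery-set-contains-difference {n} {B = B} {x} {y} recovers cx cy xi≉yi
    with k , disagree ← ¬∀⟶∃¬ n (λ k → k ∈ B → x k ≈ y k)
                                (λ k → k Subset.∈? B →-dec x k ≟ y k)
                                (λ agree → xi≉yi (recovers x y cx cy agree))
    = k
    , decidable-stable (k Subset.∈? B) (λ k∉B → disagree λ k∈B → ⊥-elim (k∉B k∈B))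
    , λ xk≈yk → disagree λ _ → xk≈yk

proposition4p2 : {c ℓ : Level} (F : FiniteField c ℓ) (n t d : ℕ)
    (C : Word F n → Set ℓ) → IsLinearCode F C →
    HasSymmetricAvailability F C t → IsMinDistance F C d →
    (1 ≤ t → 2 ≤ d) × (2 ≤ t → 3 ≤ d)
proposition4p2 F n t d C _ (A , i∉A , disjoint , recovers , _)
                           ((x , y , cx , cy , x≉y , dist≡d) , _)
  with i , xi≉yi ← some-difference F x y x≉y
  = two-differences , three-differences
  where
  differ-in : ∀ j → ∃ λ k → k ∈ A i j × Differ F x y k
  differ-in j = recovery-set-contains-difference F (recovers i j) cx cy xi≉yi

  at-least : ∀ {ks} → Unique ks → All (Differ F x y) ks → length ks ≤ d
  at-least unique differ = subst (_ ≤_) dist≡d (dist-≥-distinct-differences F x y unique differ)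

  ≢-centre : ∀ {j k} → k ∈ A i j → i ≢ k
  ≢-centre {j} k∈A refl = i∉A i j k∈A

  ≢-across : ∀ {j j' k l} → j ≢ j' → k ∈ A i j → l ∈ A i j' → k ≢ l
  ≢-across {j} {j'} {k} j≢j' k∈A l∈A refl = disjoint i j j' j≢j' k k∈A l∈A

  two-differences : 1 ≤ t → 2 ≤ d
  two-differences (s≤s _) =
    let k , k∈A₀ , xk≉yk = differ-in fzero
    in at-least ((≢-centre k∈A₀ ∷ []) ∷ [] ∷ []) (xi≉yi ∷ xk≉yk ∷ [])

  three-differences : 2 ≤ t → 3 ≤ d
  three-differences (s≤s (s≤s _)) =
    let k , k∈A₀ , xk≉yk = differ-in fzero
        l , l∈A₁ , xl≉yl = differ-in (fsuc fzero)
    in at-least ((≢-centre k∈A₀ ∷ ≢-centre l∈A₁ ∷ []) ∷ (≢-across (λ ()) k∈A₀ l∈A₁ ∷ []) ∷ [] ∷ [])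
                (xi≉yi ∷ xk≉yk ∷ xl≉yl ∷ [])
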